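{- For all integers $h,r,s$, the cardinality of every $(h,r,s)$-language is bounded by $2^{s'}\binom{h-s'+r}{r}$, where $s'=\min\{h,s\}$.
   Context: Let $\Sigma=\{\mathtt{a}_0,\mathtt{a}_1,\mathtt{b}_0,\mathtt{b}_1\}$. For integers $h,r,s$, an $(h,r,s)$-language is a language $L\subseteq\Sigma^*$ that does not contain two words of the form $uav_1$ and $ubv_2$ with $u,v_1,v_2\in\Sigma^*$, $a\in\{\mathtt{a}_0,\mathtt{a}_1\}$ and $b\in\{\mathtt{b}_0,\mathtt{b}_1\}$, and such that every $u\in L$ satisfies $|u|=h$, $|u|_{\mathtt{a}_1}\le r$ and $|u|_{\mathtt{b}_0}+|u|_{\mathtt{b}_1}\le s$, where $|u|_x$ denotes the number of occurrences of the character $x$ in $u$. -}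

module Defs where

open import Data.Nat using (ℕ; zero; suc; _+_; _≤_)
open import Data.List using (List; []; _∷_; _++_; length)
open import Data.List.Membership.Propositional using (_∈_)
open import Data.List.Relation.Unary.Unique.Propositional using (Unique)
open import Data.Product using (_×_)
open import Relation.Nullary using (¬_)
open import Relation.Binary.PropositionalEquality using (_≡_)

data Letter : Set where
  a₀ a₁ b₀ b₁ : Letter

Word : Set
Word = List Letter

data IsA : Letter → Set where
  isA₀ : IsA a₀
  isA₁ : IsA a₁

data IsB : Letter → Set where
  isB₀ : IsB b₀
  isB₁ : IsB b₁

count-a₁ : Word → ℕ
count-a₁ []        = 0
count-a₁ (a₁ ∷ u)  = suc (count-a₁ u)
count-a₁ (_  ∷ u)  = count-a₁ u

count-b : Word → ℕ
count-b []        = 0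
count-b (b₀ ∷ u)  = suc (count-b u)
count-b (b₁ ∷ u)  = suc (count-b u)
count-b (_  ∷ u)  = count-b u

record Language : Set where
  constructor mkLang
  field
    words  : List Word
    unique : Unique words
open Language public

card : Language → ℕ
card L = length (words L)

IsHRSLanguage : ℕ → ℕ → ℕ → Language → Set
IsHRSLanguage h r s L =
  (∀ (u : Word) (a b : Letter) (v₁ v₂ : Word) → IsA a → IsB b →
     (u ++ a ∷ v₁) ∈ words L → ¬ ((u ++ b ∷ v₂) ∈ words L))
  × (∀ w → w ∈ words L → length w ≡ h × count-a₁ w ≤ r × count-b w ≤ s)

-- Think of the language as a trie. Prefix-freeness between a- and
-- b-letters means that at each node either all children are reached by
-- a-letters or all by b-letters. Stripping the first letter c of the
-- words starting with c gives again such a language, of height h - 1: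
-- for c = a₀ with the same budgets, for c = a₁ with one fewer a₁, for
-- c = b₀ or b₁ with one fewer b. Hence by induction on h the maximal
-- cardinality N h r s satisfies
--   N (h+1) (r+1) s ≤ N h (r+1) s + N h r s   and   N (h+1) r (s+1) ≤ 2 N h r s,
-- and the binomial bound satisfies the same recurrences by Pascal's rule.
module Submission where

open import Defs
open import Data.Nat using (ℕ; _*_; _^_; _∸_; _⊓_; _+_; _≤_)
open import Data.Nat.Combinatorics using (_C_)

open import Data.Nat using (zero; suc; z≤n; s≤s; s≤s⁻¹; _≤′_; ≤′-refl; ≤′-step)
open import Data.Nat.Properties hiding (_≟_)
open import Data.Nat.Combinatorics using (nCn≡1; nCk+nC[k+1]≡[n+1]C[k+1])
open import Data.List using (List; []; _∷_; _++_; length)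
open import Data.List.Membership.Propositional using (_∈_; _∉_)
open import Data.List.Relation.Unary.Any using (here; there)
open import Data.List.Relation.Unary.All as All using (All; []; _∷_)
open import Data.List.Relation.Unary.AllPairs using ([]; _∷_)
open import Data.List.Relation.Unary.Unique.Propositional using (Unique)
open import Data.Product using (_,_; proj₁)
open import Function using (id)
open import Data.Sum using (_⊎_; inj₁; inj₂)
open import Data.Empty using (⊥-elim)
open import Relation.Nullary using (yes; no)
open import Relation.Binary.Definitions using (DecidableEquality)
open import Relation.Binary.PropositionalEquality

nCk≤[1+n]Ck : ∀ n k → n C k ≤ suc n C k
nCk≤[1+n]Ck n zero    = ≤-refl
nCk≤[1+n]Ck n (suc k) =
  subst (n C suc k ≤_) (nCk+nC[k+1]≡[n+1]C[k+1] n k) (m≤n+m _ _)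

C-monoˡ-≤ : ∀ {m n} k → m ≤ n → m C k ≤ n C k
C-monoˡ-≤ k m≤n = go (≤⇒≤′ m≤n)
  where
  go : ∀ {m n} → m ≤′ n → m C k ≤ n C k
  go ≤′-refl       = ≤-refl
  go (≤′-step m≤n) = ≤-trans (go m≤n) (nCk≤[1+n]Ck _ k)

C-pascal-≤ : ∀ n k → (n + suc k) C suc k + (n + k) C k ≤ (suc n + suc k) C suc k
C-pascal-≤ n k = begin
  (n + suc k) C suc k + (n + k) C k
    ≤⟨ +-monoʳ-≤ _ (C-monoˡ-≤ k (+-monoʳ-≤ n (n≤1+n k))) ⟩
  (n + suc k) C suc k + (n + suc k) C k
    ≡⟨ +-comm ((n + suc k) C suc k) _ ⟩
  (n + suc k) C k + (n + suc k) C suc k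
    ≡⟨ nCk+nC[k+1]≡[n+1]C[k+1] (n + suc k) k ⟩
  (suc n + suc k) C suc k ∎
  where open ≤-Reasoning

bound : ℕ → ℕ → ℕ → ℕ
bound h r s = 2 ^ (h ⊓ s) * ((h ∸ (h ⊓ s) + r) C r)

bound-≤ : ∀ {h s} r → s ≤ h → bound h r s ≡ 2 ^ s * ((h ∸ s + r) C r)
bound-≤ r s≤h rewrite m≥n⇒m⊓n≡n s≤h = refl

bound-≥ : ∀ {h s} r → h ≤ s → bound h r s ≡ 2 ^ h
bound-≥ {h} r h≤s rewrite m≤n⇒m⊓n≡m h≤s | n∸n≡0 h | nCn≡1 r = *-identityʳ _

bound-suc-∸ : ∀ {h s} r → s ≤ h → bound (suc h) r s ≡ 2 ^ s * ((suc (h ∸ s) + r) C r)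
bound-suc-∸ r s≤h rewrite bound-≤ r (m≤n⇒m≤1+n s≤h) | +-∸-assoc 1 s≤h = refl

bound-zero : ∀ r s → bound 0 r s ≡ 1
bound-zero r s = bound-≥ {s = s} r z≤n

bound-monoʰ : ∀ h r s → bound h r s ≤ bound (suc h) r s
bound-monoʰ h r s with ≤-<-connex s h
... | inj₁ s≤h rewrite bound-≤ r s≤h | bound-suc-∸ r s≤h =
  *-monoʳ-≤ (2 ^ s) (C-monoˡ-≤ r (n≤1+n (h ∸ s + r)))
... | inj₂ h<s rewrite bound-≥ r (<⇒≤ h<s) | bound-≥ r h<s = m≤m+n _ _

bound-pascal : ∀ h r s → bound h (suc r) s + bound h r s ≤ bound (suc h) (suc r) s
bound-pascal h r s with ≤-<-connex s h
... | inj₁ s≤h rewrite bound-≤ (suc r) s≤h | bound-≤ r s≤h | bound-suc-∸ (suc r) s≤h =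
  ≤-trans (≤-reflexive (sym (*-distribˡ-+ (2 ^ s) _ _)))
          (*-monoʳ-≤ (2 ^ s) (C-pascal-≤ (h ∸ s) r))
... | inj₂ h<s rewrite bound-≥ (suc r) (<⇒≤ h<s) | bound-≥ r (<⇒≤ h<s) | bound-≥ (suc r) h<s =
  ≤-reflexive (cong (2 ^ h +_) (sym (+-identityʳ (2 ^ h))))

bound-double : ∀ h r s → bound h r s + bound h r s ≡ bound (suc h) r (suc s)
bound-double h r s = begin
  bound h r s + bound h r s        ≡⟨ cong (bound h r s +_) (sym (+-identityʳ _)) ⟩
  2 * bound h r s                  ≡⟨ sym (*-assoc 2 (2 ^ (h ⊓ s)) _) ⟩
  bound (suc h) r (suc s)          ∎
  where open ≡-Reasoning

_≟_ : DecidableEquality Letter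
a₀ ≟ a₀ = yes refl
a₀ ≟ a₁ = no λ ()
a₀ ≟ b₀ = no λ ()
a₀ ≟ b₁ = no λ ()
a₁ ≟ a₀ = no λ ()
a₁ ≟ a₁ = yes refl
a₁ ≟ b₀ = no λ ()
a₁ ≟ b₁ = no λ ()
b₀ ≟ a₀ = no λ ()
b₀ ≟ a₁ = no λ ()
b₀ ≟ b₀ = yes refl
b₀ ≟ b₁ = no λ ()
b₁ ≟ a₀ = no λ ()
b₁ ≟ a₁ = no λ ()
b₁ ≟ b₀ = no λ ()
b₁ ≟ b₁ = yes refl

derive : Letter → List Word → List Word
derive c []             = []
derive c ([] ∷ W)       = derive c W
derive c ((d ∷ t) ∷ W) with c ≟ d
... | yes _ = t ∷ derive c W
... | no  _ = derive c W

∈-derive⁻ : ∀ c W {t} → t ∈ derive c W → c ∷ t ∈ W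
∈-derive⁻ c ([] ∷ W) t∈ = there (∈-derive⁻ c W t∈)
∈-derive⁻ c ((d ∷ _) ∷ W) t∈ with c ≟ d | t∈
... | yes refl | here refl = here refl
... | yes refl | there t∈′ = there (∈-derive⁻ c W t∈′)
... | no  _    | t∈′       = there (∈-derive⁻ c W t∈′)

derive-unique : ∀ c W → Unique W → Unique (derive c W)
derive-unique c []             []         = []
derive-unique c ([] ∷ W)       (_ ∷ uW)   = derive-unique c W uW
derive-unique c ((d ∷ t) ∷ W) (t∉ ∷ uW) with c ≟ d
... | yes refl = All.tabulate (λ t′∈ t≡t′ → All.lookup t∉ (∈-derive⁻ c W t′∈) (cong (c ∷_) t≡t′))
               ∷ derive-unique c W uW
... | no  _    = derive-unique c W uW

derive-≡[] : ∀ c W → (∀ {t} → c ∷ t ∉ W) → derive c W ≡ []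
derive-≡[] c W ∉W with derive c W in eq
... | []    = refl
... | t ∷ _ = ⊥-elim (∉W (∈-derive⁻ c W (subst (t ∈_) (sym eq) (here refl))))

derivative : Letter → Language → Language
derivative c L = mkLang (derive c (words L)) (derive-unique c (words L) (unique L))

derivative-isHRS : ∀ c {h r s r′ s′} (L : Language) →
  (∀ {t} → count-a₁ (c ∷ t) ≤ r → count-a₁ t ≤ r′) →
  (∀ {t} → count-b (c ∷ t) ≤ s → count-b t ≤ s′) →
  IsHRSLanguage (suc h) r s L → IsHRSLanguage h r′ s′ (derivative c L)
derivative-isHRS c L a₁-budget b-budget (separated , bounded) =
  (λ u a b v₁ v₂ isA isB a∈ b∈ →
     separated (c ∷ u) a b v₁ v₂ isA isB (∈-derive⁻ c W a∈) (∈-derive⁻ c W b∈)) ,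
  λ t t∈ → let length≡ , a₁≤ , b≤ = bounded (c ∷ t) (∈-derive⁻ c W t∈)
           in suc-injective length≡ , a₁-budget a₁≤ , b-budget b≤
  where W = words L

Separated : List Word → Set
Separated W = ∀ u a b v₁ v₂ → IsA a → IsB b → u ++ a ∷ v₁ ∈ W → u ++ b ∷ v₂ ∉ W

aBranches bBranches : List Word → ℕ
aBranches W = length (derive a₀ W) + length (derive a₁ W)
bBranches W = length (derive b₀ W) + length (derive b₁ W)

branches-∷ : ∀ c t W →
  aBranches ((c ∷ t) ∷ W) + bBranches ((c ∷ t) ∷ W) ≡ suc (aBranches W + bBranches W)
branches-∷ a₀ t W = refl
branches-∷ a₁ t W = cong (_+ bBranches W) (+-suc (length (derive a₀ W)) (length (derive a₁ W)))
branches-∷ b₀ t W = +-suc (aBranches W) (bBranches W)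
branches-∷ b₁ t W = begin
  aBranches W + (length (derive b₀ W) + suc (length (derive b₁ W)))
    ≡⟨ cong (aBranches W +_) (+-suc (length (derive b₀ W)) (length (derive b₁ W))) ⟩
  aBranches W + suc (bBranches W)
    ≡⟨ +-suc (aBranches W) (bBranches W) ⟩
  suc (aBranches W + bBranches W) ∎
  where open ≡-Reasoning

length≤branches : ∀ W → All (_≢ []) W → length W ≤ aBranches W + bBranches W
length≤branches []             []            = z≤n
length≤branches ([] ∷ W)       ([]≢[] ∷ _)   = ⊥-elim ([]≢[] refl)
length≤branches ((c ∷ t) ∷ W) (_ ∷ nonEmpty) =
  ≤-trans (s≤s (length≤branches W nonEmpty)) (≤-reflexive (sym (branches-∷ c t W)))

aBranches≡0 : ∀ W → Separated W → ∀ {b t} → IsB b → t ∈ derive b W → aBranches W ≡ 0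
aBranches≡0 W separated {b} {t} isB t∈ =
  cong₂ (λ xs ys → length xs + length ys) (no-a a₀ isA₀) (no-a a₁ isA₁)
  where
  no-a : ∀ a → IsA a → derive a W ≡ []
  no-a a isA = derive-≡[] a W λ a∈ →
    separated [] a b _ t isA isB a∈ (∈-derive⁻ b W t∈)

separated-root : ∀ W → Separated W → aBranches W ≡ 0 ⊎ bBranches W ≡ 0
separated-root W separated with derive b₀ W in e₀ | derive b₁ W in e₁
... | t ∷ _ | _     = inj₁ (aBranches≡0 W separated isB₀ (subst (t ∈_) (sym e₀) (here refl)))
... | []    | t ∷ _ = inj₁ (aBranches≡0 W separated isB₁ (subst (t ∈_) (sym e₁) (here refl)))
... | []    | []    = inj₂ refl

unique-pairwiseEqual⇒length≤1 : ∀ {A : Set} {xs : List A} → Unique xs →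
  (∀ {x y} → x ∈ xs → y ∈ xs → x ≡ y) → length xs ≤ 1
unique-pairwiseEqual⇒length≤1 {xs = []}        _                 _ = z≤n
unique-pairwiseEqual⇒length≤1 {xs = _ ∷ []}    _                 _ = ≤-refl
unique-pairwiseEqual⇒length≤1 {xs = _ ∷ _ ∷ _} ((x≢y ∷ _) ∷ _) eq =
  ⊥-elim (x≢y (eq (here refl) (there (here refl))))

CardBound : ℕ → Set
CardBound h = ∀ r s (L : Language) → IsHRSLanguage h r s L → card L ≤ bound h r s

card-bound-zero : CardBound 0
card-bound-zero r s L (_ , bounded) =
  subst (card L ≤_) (sym (bound-zero r s))
        (unique-pairwiseEqual⇒length≤1 (unique L) λ x∈ y∈ →
           empty-words (proj₁ (bounded _ x∈)) (proj₁ (bounded _ y∈)))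
  where
  empty-words : ∀ {u v : Word} → length u ≡ 0 → length v ≡ 0 → u ≡ v
  empty-words {[]} {[]} _ _ = refl

aBranches≤bound : ∀ {h} → CardBound h → ∀ r s (L : Language) →
  IsHRSLanguage (suc h) r s L → aBranches (words L) ≤ bound (suc h) r s
aBranches≤bound {h} ih zero s L hrs@(_ , bounded) = begin
  length (derive a₀ W) + length (derive a₁ W)
    ≡⟨ cong (λ xs → length (derive a₀ W) + length xs) (derive-≡[] a₁ W no-a₁) ⟩
  length (derive a₀ W) + 0
    ≡⟨ +-identityʳ _ ⟩
  card (derivative a₀ L)
    ≤⟨ ih zero s (derivative a₀ L) (derivative-isHRS a₀ L id id hrs) ⟩
  bound h zero s
    ≤⟨ bound-monoʰ h zero s ⟩
  bound (suc h) zero s ∎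
  where
  open ≤-Reasoning
  W = words L
  no-a₁ : ∀ {t} → a₁ ∷ t ∉ W
  no-a₁ t∈ with bounded _ t∈
  ... | _ , () , _
aBranches≤bound {h} ih (suc r) s L hrs =
  ≤-trans (+-mono-≤ (ih (suc r) s (derivative a₀ L) (derivative-isHRS a₀ L id id hrs))
                    (ih r s (derivative a₁ L) (derivative-isHRS a₁ L s≤s⁻¹ id hrs)))
          (bound-pascal h r s)

bBranches≤bound : ∀ {h} → CardBound h → ∀ r s (L : Language) →
  IsHRSLanguage (suc h) r s L → bBranches (words L) ≤ bound (suc h) r s
bBranches≤bound {h} ih r zero L (_ , bounded) =
  subst (_≤ bound (suc h) r zero)
        (sym (cong₂ (λ xs ys → length xs + length ys) (derive-≡[] b₀ W no-b₀) (derive-≡[] b₁ W no-b₁)))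
        z≤n
  where
  W = words L
  no-b₀ : ∀ {t} → b₀ ∷ t ∉ W
  no-b₀ t∈ with bounded _ t∈
  ... | _ , _ , ()
  no-b₁ : ∀ {t} → b₁ ∷ t ∉ W
  no-b₁ t∈ with bounded _ t∈
  ... | _ , _ , ()
bBranches≤bound {h} ih r (suc s) L hrs =
  ≤-trans (+-mono-≤ (ih r s (derivative b₀ L) (derivative-isHRS b₀ L id s≤s⁻¹ hrs))
                    (ih r s (derivative b₁ L) (derivative-isHRS b₁ L id s≤s⁻¹ hrs)))
          (≤-reflexive (bound-double h r s))

card-bound : ∀ h → CardBound h
card-bound zero    = card-bound-zero
card-bound (suc h) r s L hrs@(separated , bounded) = begin
  card L                   ≤⟨ length≤branches W (All.tabulate nonEmpty) ⟩
  aBranches W + bBranches W ≤⟨ one-side (separated-root W separated) ⟩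
  bound (suc h) r s        ∎
  where
  open ≤-Reasoning
  W = words L
  nonEmpty : ∀ {w} → w ∈ W → w ≢ []
  nonEmpty w∈ refl with bounded _ w∈
  ... | () , _
  one-side : aBranches W ≡ 0 ⊎ bBranches W ≡ 0 → aBranches W + bBranches W ≤ bound (suc h) r s
  one-side (inj₁ a≡0) rewrite a≡0 = bBranches≤bound (card-bound h) r s L hrs
  one-side (inj₂ b≡0) rewrite b≡0 | +-identityʳ (aBranches W) = aBranches≤bound (card-bound h) r s L hrs

mainTheorem20 : ∀ (h r s : ℕ) (L : Language) → IsHRSLanguage h r s L →
    card L ≤ 2 ^ (h ⊓ s) * ((h ∸ (h ⊓ s) + r) C r)
mainTheorem20 = card-bound
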